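{- Let $G$ be a graph with $\pi^*(G)\leq 3$. Then $\pi^*_2(G)=\pi^*(G)$.
   Context: All graphs are finite and simple. A pebble distribution on a graph $G$ is a function $D:V(G)\to\mathbb{Z}_{\geq 0}$; its size is $|D|=\sum_v D(v)$. A pebbling move removes two pebbles from a vertex having at least two pebbles and places one pebble on an adjacent vertex. A vertex is reachable under $D$ if some sequence of pebbling moves, each applied to a vertex having at least two pebbles at that time, results in at least one pebble on it. $D$ is solvable if every vertex is reachable. $\pi^*(G)$ is the minimum size of a solvable distribution. A distribution is $2$-restricted if $D(v)\leq 2$ for all $v$; $\pi^*_2(G)$ is the minimum size of a solvable $2$-restricted distribution. -}

module Defs where

open import Data.Nat using (ℕ; _+_; _≤_; _≥_)
open import Data.Fin using (Fin)
open import Data.List using (map; allFin)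
open import Data.Nat.ListAction using (sum)
open import Data.Product using (_×_; Σ; ∃)
open import Relation.Binary.PropositionalEquality using (_≡_; _≢_)
open import Relation.Binary.Construct.Closure.ReflexiveTransitive using (Star)
open import Relation.Nullary using (¬_)

record Graph (n : ℕ) : Set₁ where
  field
    Adj     : Fin n → Fin n → Set
    sym     : ∀ {u v} → Adj u v → Adj v u
    irrefl  : ∀ {u} → ¬ Adj u u

Distribution : ℕ → Set
Distribution n = Fin n → ℕ

size : ∀ {n} → Distribution n → ℕ
size {n} D = sum (map D (allFin n))

data Move {n : ℕ} (G : Graph n) (D D' : Distribution n) : Set where
  move : (u v : Fin n) → Graph.Adj G u v →
         D' u + 2 ≡ D u →
         D' v ≡ D v + 1 →
         (∀ w → w ≢ u → w ≢ v → D' w ≡ D w) →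
         Move G D D'

Moves : ∀ {n} → Graph n → Distribution n → Distribution n → Set
Moves G = Star (Move G)

Reachable : ∀ {n} → Graph n → Distribution n → Fin n → Set
Reachable G D t = ∃ λ D' → Moves G D D' × D' t ≥ 1

Solvable : ∀ {n} → Graph n → Distribution n → Set
Solvable G D = ∀ t → Reachable G D t

TwoRestricted : ∀ {n} → Distribution n → Set
TwoRestricted D = ∀ v → D v ≤ 2

IsOptimalPebblingNumber : ∀ {n} → Graph n → ℕ → Set
IsOptimalPebblingNumber G k =
  (Σ _ λ D → Solvable G D × size D ≡ k) ×
  (∀ D → Solvable G D → k ≤ size D)

IsRestrictedOptimalPebblingNumber : ∀ {n} → Graph n → ℕ → Set
IsRestrictedOptimalPebblingNumber G k =
  (Σ _ λ D → TwoRestricted D × Solvable G D × size D ≡ k) ×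
  (∀ D → TwoRestricted D → Solvable G D → k ≤ size D)

{-# OPTIONS --safe #-}
module Submission where

-- If an optimal distribution of size at most 3 is not 2-restricted, it must be
-- three pebbles on a single vertex v.  From there a single move is possible,
-- after which no vertex holds two pebbles, so every vertex is v or a neighbour
-- of v.  But then two pebbles on v already solve G, contradicting optimality.

open import Defs
open import Data.Nat using (ℕ; zero; suc; _+_; _≤_; _<_; z≤n; s≤s; _≤?_)
open import Data.Nat.Properties
  using (≤-refl; ≤-trans; m≤m+n; m≤n+m; +-monoʳ-≤; +-monoˡ-≤; +-comm; +-cancelˡ-≤; +-cancelʳ-≤;
         n≤0⇒n≡0; ≰⇒>; <⇒≱)
open import Data.Fin using (Fin; zero; suc; _≟_)
open import Data.Fin.Properties using (all?; ¬∀⟶∃¬; suc-injective)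
open import Data.List.Properties using (map-tabulate)
open import Data.Nat.ListAction using (sum)
open import Data.Product using (_,_)
open import Data.Sum using (_⊎_; inj₁; inj₂)
open import Data.Empty using (⊥-elim)
open import Function using (_∘_; id)
open import Relation.Nullary using (¬_; yes; no)
open import Relation.Binary.PropositionalEquality
open import Relation.Binary.Construct.Closure.ReflexiveTransitive using (ε; _◅_)

size-suc : ∀ {n} (D : Distribution (suc n)) → size D ≡ D zero + size (D ∘ suc)
size-suc D = cong (λ ds → D zero + sum ds)
  (trans (map-tabulate suc D) (sym (map-tabulate id (D ∘ suc))))

≤-size : ∀ {n} (D : Distribution n) v → D v ≤ size D
≤-size D zero    rewrite size-suc D = m≤m+n _ _
≤-size D (suc v) rewrite size-suc D = ≤-trans (≤-size (D ∘ suc) v) (m≤n+m _ _)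

+-≤-size : ∀ {n} (D : Distribution n) {v w} → v ≢ w → D v + D w ≤ size D
+-≤-size D {zero}  {zero}  v≢w = ⊥-elim (v≢w refl)
+-≤-size D {zero}  {suc w} _   rewrite size-suc D = +-monoʳ-≤ (D zero) (≤-size (D ∘ suc) w)
+-≤-size D {suc v} {zero}  _   rewrite size-suc D | +-comm (D (suc v)) (D zero) =
  +-monoʳ-≤ (D zero) (≤-size (D ∘ suc) v)
+-≤-size D {suc v} {suc w} v≢w rewrite size-suc D =
  ≤-trans (+-≤-size (D ∘ suc) (v≢w ∘ cong suc)) (m≤n+m _ _)

Concentrated : ∀ {n} → Distribution n → Fin n → Set
Concentrated D v = ∀ w → w ≢ v → D w ≡ 0

size-zero : ∀ {n} (D : Distribution n) → (∀ w → D w ≡ 0) → size D ≡ 0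
size-zero {zero}  D D≡0 = refl
size-zero {suc n} D D≡0 rewrite size-suc D | D≡0 zero = size-zero (D ∘ suc) (D≡0 ∘ suc)

size-concentrated : ∀ {n} (D : Distribution n) {v} → Concentrated D v → size D ≡ D v
size-concentrated D {zero} conc
  rewrite size-suc D | size-zero (D ∘ suc) (λ w → conc (suc w) λ ()) = +-comm (D zero) 0
size-concentrated D {suc v} conc rewrite size-suc D | conc zero (λ ()) =
  size-concentrated (D ∘ suc) (λ w w≢v → conc (suc w) (w≢v ∘ suc-injective))

pile : ∀ {n} → Fin n → ℕ → Distribution n
pile v c w with w ≟ v
... | yes _ = c
... | no  _ = 0

pile-at : ∀ {n} (v : Fin n) c → pile v c v ≡ c
pile-at v c with v ≟ v
... | yes _   = refl
... | no  v≢v = ⊥-elim (v≢v refl)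

pile-concentrated : ∀ {n} (v : Fin n) c → Concentrated (pile v c) v
pile-concentrated v c w w≢v with w ≟ v
... | yes w≡v = ⊥-elim (w≢v w≡v)
... | no  _   = refl

size-pile : ∀ {n} (v : Fin n) c → size (pile v c) ≡ c
size-pile v c = trans (size-concentrated (pile v c) (pile-concentrated v c)) (pile-at v c)

concentrated-occupied : ∀ {n} {D : Distribution n} {v t} → Concentrated D v → 1 ≤ D t → t ≡ v
concentrated-occupied {v = v} {t} conc 1≤Dt with t ≟ v
... | yes t≡v = t≡v
... | no  t≢v = ⊥-elim (<⇒≱ 1≤Dt (subst (_≤ 0) (sym (conc t t≢v)) ≤-refl))

move-source-≥2 : ∀ {a b} → a + 2 ≡ b → 2 ≤ b
move-source-≥2 {a} refl = m≤n+m 2 a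

Stuck : ∀ {n} → Distribution n → Set
Stuck D = ∀ w → D w ≤ 1

stuck-no-move : ∀ {n} {G : Graph n} {D D'} → Stuck D → ¬ Move G D D'
stuck-no-move stuck (move u _ _ source _ _) = <⇒≱ (move-source-≥2 source) (stuck u)

reachable-stuck : ∀ {n} {G : Graph n} {D} → Stuck D → ∀ {t} → Reachable G D t → 1 ≤ D t
reachable-stuck stuck (_ , ε     , 1≤Dt) = 1≤Dt
reachable-stuck stuck (_ , m ◅ _ , _)    = ⊥-elim (stuck-no-move stuck m)

Dominating : ∀ {n} → Graph n → Fin n → Set
Dominating G v = ∀ t → t ≡ v ⊎ Graph.Adj G v t

-- With at most three pebbles on v, the first move must leave v and land on a
-- neighbour x, and afterwards at most one pebble remains anywhere.
reachable-small-pile : ∀ {n} (G : Graph n) {D v} → Concentrated D v → D v ≤ 3 →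
  ∀ {t} → Reachable G D t → t ≡ v ⊎ Graph.Adj G v t
reachable-small-pile G conc Dv≤3 (_ , ε , 1≤Dt) = inj₁ (concentrated-occupied conc 1≤Dt)
reachable-small-pile G {v = v} conc Dv≤3 {t} (D' , move u x adj source target rest ◅ moves , 1≤D't)
  with u ≟ v
... | no u≢v = ⊥-elim (<⇒≱ (move-source-≥2 source) (subst (_≤ 1) (sym (conc u u≢v)) z≤n))
... | yes refl with t ≟ u
...   | yes t≡u = inj₁ t≡u
...   | no t≢u with t ≟ x
...     | yes refl = inj₂ adj
...     | no t≢x = ⊥-elim (<⇒≱ (reachable-stuck stuck (D' , moves , 1≤D't))
                              (subst (_≤ 0) (sym (trans (rest t t≢u t≢x) (conc t t≢u))) ≤-refl))
  where
  x≢u : x ≢ u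
  x≢u refl = Graph.irrefl G adj
  stuck : Stuck _
  stuck w with w ≟ u
  ... | yes refl = +-cancelʳ-≤ 2 _ 1 (subst (_≤ 3) (sym source) Dv≤3)
  ... | no w≢u with w ≟ x
  ...   | yes refl = subst (_≤ 1) (sym (trans target (cong (_+ 1) (conc x x≢u)))) ≤-refl
  ...   | no w≢x = subst (_≤ 1) (sym (trans (rest w w≢u w≢x) (conc w w≢u))) z≤n

pile-2-solvable : ∀ {n} (G : Graph n) {v} → Dominating G v → Solvable G (pile v 2)
pile-2-solvable G {v} dom t with dom t
... | inj₁ refl = pile v 2 , ε , subst (1 ≤_) (sym (pile-at v 2)) (s≤s z≤n)
... | inj₂ adj  = pile t 1 , step ◅ ε , subst (1 ≤_) (sym (pile-at t 1)) ≤-refl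
  where
  t≢v : t ≢ v
  t≢v refl = Graph.irrefl G adj
  step : Move G (pile v 2) (pile t 1)
  step = move v t adj
    (trans (cong (_+ 2) (pile-concentrated t 1 v (t≢v ∘ sym))) (sym (pile-at v 2)))
    (trans (pile-at t 1) (cong (_+ 1) (sym (pile-concentrated v 2 t t≢v))))
    (λ w w≢v w≢t → trans (pile-concentrated t 1 w w≢t) (sym (pile-concentrated v 2 w w≢v)))

concentrated-if-large : ∀ {n} (D : Distribution n) {v} → 3 ≤ D v → size D ≤ 3 → Concentrated D v
concentrated-if-large D {v} 3≤Dv size≤3 w w≢v = n≤0⇒n≡0 (+-cancelˡ-≤ 3 _ 0 (begin
  3 + D w   ≤⟨ +-monoˡ-≤ (D w) 3≤Dv ⟩
  D v + D w ≤⟨ +-≤-size D (w≢v ∘ sym) ⟩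
  size D    ≤⟨ size≤3 ⟩
  3 + 0     ∎))
  where open Data.Nat.Properties.≤-Reasoning

optimal-large-pile : ∀ {n} (G : Graph n) {k} → IsOptimalPebblingNumber G k → k ≤ 3 →
  ∀ (D : Distribution n) {v} → Solvable G D → size D ≡ k → ¬ 3 ≤ D v
optimal-large-pile G {k} (_ , minimal) k≤3 D {v} solvable size≡k 3≤Dv =
  <⇒≱ 2<k (subst (k ≤_) (size-pile v 2) (minimal (pile v 2) (pile-2-solvable G dominating)))
  where
  size≤3 : size D ≤ 3
  size≤3 = subst (_≤ 3) (sym size≡k) k≤3
  dominating : Dominating G v
  dominating t = reachable-small-pile G (concentrated-if-large D 3≤Dv size≤3)
                   (≤-trans (≤-size D v) size≤3) (solvable t)
  2<k : 2 < k
  2<k = subst (3 ≤_) size≡k (≤-trans 3≤Dv (≤-size D v))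

mainTheorem6 : ∀ (n : ℕ) (G : Graph n) (k : ℕ) →
    IsOptimalPebblingNumber G k → k ≤ 3 →
    IsRestrictedOptimalPebblingNumber G k
mainTheorem6 n G k optimal@((D , solvable , size≡k) , minimal) k≤3 =
  (D , restricted , solvable , size≡k) , λ D' _ → minimal D'
  where
  restricted : TwoRestricted D
  restricted with all? (λ v → D v ≤? 2)
  ... | yes D≤2 = D≤2
  ... | no ¬D≤2 with ¬∀⟶∃¬ n _ (λ v → D v ≤? 2) ¬D≤2
  ...   | v , Dv≰2 = ⊥-elim (optimal-large-pile G optimal k≤3 D solvable size≡k (≰⇒> Dv≰2))
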